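{- Let $\Gamma$ be a strongly regular graph with parameters $(v,k,\lambda,\mu)$ and restricted eigenvalues $\rho>\sigma$, and let $d$ be an integer with $0\le d\le k$. Then $\mathrm{Rab}_{\geq}(\Gamma,d)\le \lfloor \mathrm{Haem}_{\geq}(\Gamma,d)\rfloor$, and (when $\Gamma$ is connected, which is when $\mathrm{Haem}_{\leq}(\Gamma,d)$ is defined) $\mathrm{Rab}_{\leq}(\Gamma,d)\ge \lceil \mathrm{Haem}_{\leq}(\Gamma,d)\rceil$.
   Context: A graph is strongly regular with parameters $(v,k,\lambda,\mu)$ if it has $v$ vertices, is $k$-regular, is neither complete nor edgeless, every two adjacent vertices have exactly $\lambda$ common neighbours, and every two distinct non-adjacent vertices have exactly $\mu$ common neighbours. Its restricted eigenvalues $\rho>\sigma$ are the two roots of $t^2-(\lambda-\mu)t-(k-\mu)=0$ (the eigenvalues of the adjacency matrix on eigenvectors orthogonal to the all-ones vector); $\rho\ge 0>\sigma$, and $\rho$ is the second largest eigenvalue when $\Gamma$ is connected. Define $\mathrm{Haem}_{\geq}(\Gamma,d)=v\frac{d-\sigma}{k-\sigma}$ and, for connected $\Gamma$, $\mathrm{Haem}_{\leq}(\Gamma,d)=v\frac{d-\rho}{k-\rho}$. The regular adjacency polynomial is $R_\Gamma(x,y,d)=x(x+1)(v-y)-2xyk+(2x+\lambda-\mu+1)yd+y(y-1)\mu-yd^2$. Let $S_d=\{y\in\{d+1,\dots,v\}: R_\Gamma(x,y,d)\ge 0 \text{ for all integers } x\}$; $\mathrm{Rab}_{\geq}(\Gamma,d)=\max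 S_d$ if $S_d\neq\emptyset$, else $0$; $\mathrm{Rab}_{\leq}(\Gamma,d)=\min S_d$ if $S_d\neq\emptyset$, else $v+1$. -}

module Defs where

open import Data.Bool using (Bool; true; false; _∧_)
open import Data.Nat as ℕ using (ℕ; zero; suc)
open import Data.Fin using (Fin)
import Data.Fin as F
open import Data.Integer as ℤ using (ℤ; +_; _+_; _-_; _*_; -_)
open import Data.Product using (Σ; ∃; _×_; _,_)
open import Data.Sum using (_⊎_)
open import Relation.Nullary using (¬_)
open import Relation.Binary.PropositionalEquality using (_≡_; _≢_)

record Graph (v : ℕ) : Set where
  field
    adj    : Fin v → Fin v → Bool
    sym    : ∀ i j → adj i j ≡ adj j i
    irrefl : ∀ i → adj i i ≡ false
open Graph public

count : ∀ n → (Fin n → Bool) → ℕ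
count zero    p = zero
count (suc n) p with p F.zero
... | true  = suc (count n (λ i → p (F.suc i)))
... | false = count n (λ i → p (F.suc i))

degree : ∀ {v} → Graph v → Fin v → ℕ
degree {v} G i = count v (adj G i)

commonNeighbours : ∀ {v} → Graph v → Fin v → Fin v → ℕ
commonNeighbours {v} G i j = count v (λ w → adj G i w ∧ adj G j w)

IsSRG : ∀ {v} → Graph v → (k l m : ℕ) → Set
IsSRG {v} G k l m =
  (∀ i → degree G i ≡ k)
  × (∀ i j → i ≢ j → adj G i j ≡ true → commonNeighbours G i j ≡ l)
  × (∀ i j → i ≢ j → adj G i j ≡ false → commonNeighbours G i j ≡ m)
  × (∃ λ i → ∃ λ j → i ≢ j × adj G i j ≡ false)
  × (∃ λ i → ∃ λ j → adj G i j ≡ true)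

data Reachable {v} (G : Graph v) : Fin v → Fin v → Set where
  here : ∀ {i} → Reachable G i i
  step : ∀ {i j w} → adj G i j ≡ true → Reachable G j w → Reachable G i w

Connected : ∀ {v} → Graph v → Set
Connected {v} G = ∀ (i j : Fin v) → Reachable G i j

-- Exact arithmetic in ℤ[√D]: a pair (a , b) denotes the real a + b√D
-- (D ≥ 0 is assumed by the user; here D is the discriminant).

Surd : Set
Surd = ℤ × ℤ

sAdd : Surd → Surd → Surd
sAdd (a , b) (c , d) = (a + c , b + d)

sNeg : Surd → Surd
sNeg (a , b) = (- a , - b)

sMul : ℤ → Surd → Surd → Surd
sMul D (a , b) (c , d) = (a * c + b * d * D , a * d + b * c)

ofℤ : ℤ → Surd
ofℤ n = (n , + 0)

-- a + b√D ≥ 0 (as a real number), decided exactly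
NonNeg : ℤ → Surd → Set
NonNeg D (a , b) =
    (+ 0 ℤ.≤ a × + 0 ℤ.≤ b)
  ⊎ (+ 0 ℤ.≤ a × b ℤ.< + 0 × b * b * D ℤ.≤ a * a)
  ⊎ (a ℤ.< + 0 × + 0 ℤ.≤ b × a * a ℤ.≤ b * b * D)

_≤[_]_ : Surd → ℤ → Surd → Set
x ≤[ D ] y = NonNeg D (sAdd y (sNeg x))

_<[_]_ : Surd → ℤ → Surd → Set
x <[ D ] y = ¬ (y ≤[ D ] x)

-- A "fraction" num / den of elements of ℤ[√D] with den > 0.
-- n is the floor of num/den  iff  n ≤ num/den < n+1,
-- i.e. (den > 0)  n·den ≤ num < (n+1)·den.
IsFloorFrac : ℤ → Surd → Surd → ℤ → Set
IsFloorFrac D num den n =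
  sMul D (ofℤ n) den ≤[ D ] num × num <[ D ] sMul D (ofℤ (n + + 1)) den

-- n is the ceiling of num/den  iff  n-1 < num/den ≤ n.
IsCeilFrac : ℤ → Surd → Surd → ℤ → Set
IsCeilFrac D num den n =
  sMul D (ofℤ (n - + 1)) den <[ D ] num × num ≤[ D ] sMul D (ofℤ n) den

-- Restricted eigenvalues: roots of t² - (λ-μ)t - (k-μ).
-- With Δ = (λ-μ)² + 4(k-μ):  2ρ = (λ-μ) + √Δ,  2σ = (λ-μ) - √Δ.

module SRGParams (v k l m : ℕ) where
  L : ℤ
  L = + l - + m

  Δ : ℤ
  Δ = L * L + + 4 * (+ k - + m)

  twoρ : Surd
  twoρ = (L , + 1)

  twoσ : Surd
  twoσ = (L , - (+ 1))

  -- Haem_≥ = v (d-σ)/(k-σ) = v(2d - 2σ) / (2k - 2σ)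
  haemGeNum : ℕ → Surd
  haemGeNum d = sMul Δ (ofℤ (+ v)) (sAdd (ofℤ (+ (2 ℕ.* d))) (sNeg twoσ))

  haemGeDen : Surd
  haemGeDen = sAdd (ofℤ (+ (2 ℕ.* k))) (sNeg twoσ)

  -- Haem_≤ = v (d-ρ)/(k-ρ) = v(2d - 2ρ) / (2k - 2ρ)
  haemLeNum : ℕ → Surd
  haemLeNum d = sMul Δ (ofℤ (+ v)) (sAdd (ofℤ (+ (2 ℕ.* d))) (sNeg twoρ))

  haemLeDen : Surd
  haemLeDen = sAdd (ofℤ (+ (2 ℕ.* k))) (sNeg twoρ)

  IsFloorHaemGe : ℕ → ℤ → Set
  IsFloorHaemGe d n = IsFloorFrac Δ (haemGeNum d) haemGeDen n

  IsCeilHaemLe : ℕ → ℤ → Set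
  IsCeilHaemLe d n = IsCeilFrac Δ (haemLeNum d) haemLeDen n

  R : ℤ → ℤ → ℤ → ℤ
  R x y d = x * (x + + 1) * (+ v - y) - + 2 * x * y * + k
          + (+ 2 * x + L + + 1) * y * d + y * (y - + 1) * + m - y * d * d

  InS : ℕ → ℕ → Set
  InS d y = d ℕ.< y × y ℕ.≤ v × (∀ (x : ℤ) → + 0 ℤ.≤ R x (+ y) (+ d))

  IsRabGe : ℕ → ℕ → Set
  IsRabGe d r = (InS d r × (∀ y → InS d y → y ℕ.≤ r))
              ⊎ ((∀ y → ¬ InS d y) × r ≡ 0)

  IsRabLe : ℕ → ℕ → Set
  IsRabLe d r = (InS d r × (∀ y → InS d y → r ℕ.≤ y))
              ⊎ ((∀ y → ¬ InS d y) × r ≡ suc v)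

{-# OPTIONS --safe #-}
module Submission where

-- Double counting the edges between the neighbourhood of a vertex and its non-neighbours gives
-- k(k - λ - 1) = (v - k - 1)μ. For y ∈ S_d with y < v, x ↦ R(x,y,d) is a quadratic with leading
-- coefficient v - y > 0; evaluating it at x = ⌊y(k - d)/(v - y)⌋ shows that its completed square
-- W = (v - y)(R(0,y,d) + y(k - d)) - y²(k - d)² is nonnegative. By the counting identity,
-- vW = -y·Q(vd - yk, v - y), where Q(s,w) = s² - (λ-μ)sw - (k-μ)w² is the homogenised polynomial
-- whose roots are ρ and σ; hence σ ≤ (vd - yk)/(v - y) ≤ ρ, which rearranges to
-- Haem_≤(Γ,d) ≤ y ≤ Haem_≥(Γ,d). For y = v the polynomial is linear in x, which forces d = k.
-- The empty cases Rab_≥ = 0 and Rab_≤ = v + 1 follow from 0 ≤ Haem_≥ and Haem_≤ ≤ v. All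
-- comparisons with √Δ are decided exactly in ℤ[√Δ], by squaring.

module Counting where

  open import Defs hiding (sym)
  open import Data.Bool using (Bool; true; false; _∧_; not)
  open import Data.Bool.Properties using (∧-assoc; ∧-zeroʳ; ∧-identityʳ)
  open import Data.Nat using (ℕ; zero; suc; _+_; _*_; _≤_; z≤n)
  open import Data.Nat.Properties hiding (_≟_)
  open import Data.Fin using (Fin; _≟_)
  import Data.Fin as F
  open import Data.Product using (_,_; proj₁; proj₂)
  open import Relation.Nullary using (does)
  open import Relation.Nullary.Decidable using (dec-true)
  open import Relation.Binary.PropositionalEquality
  open import Algebra.Properties.Semiring.Sum +-*-semiring
    using (sum; sum-syntax; sum-cong-≗; ∑-distrib-+; ∑-comm; *-distribˡ-sum; *-distribʳ-sum;
           sum-replicate-zero)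

  𝟙 : Bool → ℕ
  𝟙 true  = 1
  𝟙 false = 0

  count≡∑𝟙 : ∀ n p → count n p ≡ ∑[ i < n ] 𝟙 (p i)
  count≡∑𝟙 zero    p = refl
  count≡∑𝟙 (suc n) p with p F.zero
  ... | true  = cong suc (count≡∑𝟙 n (λ i → p (F.suc i)))
  ... | false = count≡∑𝟙 n (λ i → p (F.suc i))

  𝟙-∧ : ∀ a b → 𝟙 (a ∧ b) ≡ 𝟙 a * 𝟙 b
  𝟙-∧ true  b = sym (+-identityʳ (𝟙 b))
  𝟙-∧ false b = refl

  𝟙-∧≤ : ∀ a b → 𝟙 (a ∧ b) ≤ 𝟙 a
  𝟙-∧≤ true  true  = ≤-refl
  𝟙-∧≤ true  false = z≤n
  𝟙-∧≤ false b     = z≤n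

  𝟙-split : ∀ a b → 𝟙 a ≡ 𝟙 (a ∧ b) + 𝟙 (a ∧ not b)
  𝟙-split true  true  = refl
  𝟙-split true  false = refl
  𝟙-split false b     = refl

  𝟙-*-cong : ∀ b {x y} → (b ≡ true → x ≡ y) → 𝟙 b * x ≡ 𝟙 b * y
  𝟙-*-cong true  x≡y = cong (_+ 0) (x≡y refl)
  𝟙-*-cong false x≡y = refl

  ∑-mono : ∀ {n} {f g : Fin n → ℕ} → (∀ i → f i ≤ g i) → sum f ≤ sum g
  ∑-mono {zero}  f≤g = z≤n
  ∑-mono {suc n} f≤g = +-mono-≤ (f≤g F.zero) (∑-mono (λ i → f≤g (F.suc i)))

  ∑𝟙-true : ∀ n → ∑[ i < n ] 𝟙 true ≡ n
  ∑𝟙-true zero    = refl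
  ∑𝟙-true (suc n) = cong suc (∑𝟙-true n)

  ∑𝟙-split : ∀ {n} (p q : Fin n → Bool) →
    ∑[ i < n ] 𝟙 (p i) ≡ ∑[ i < n ] 𝟙 (p i ∧ q i) + ∑[ i < n ] 𝟙 (p i ∧ not (q i))
  ∑𝟙-split p q = trans (sum-cong-≗ (λ i → 𝟙-split (p i) (q i)))
                       (∑-distrib-+ (λ i → 𝟙 (p i ∧ q i)) (λ i → 𝟙 (p i ∧ not (q i))))

  ∑𝟙-∧-≟ : ∀ {n} (p : Fin n → Bool) (j : Fin n) → ∑[ i < n ] 𝟙 (p i ∧ does (i ≟ j)) ≡ 𝟙 (p j)
  ∑𝟙-∧-≟ {suc n} p F.zero = begin
    𝟙 (p F.zero ∧ true) + ∑[ i < n ] 𝟙 (p (F.suc i) ∧ false)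
      ≡⟨ cong₂ _+_ (cong 𝟙 (∧-identityʳ (p F.zero)))
                   (sum-cong-≗ (λ i → cong 𝟙 (∧-zeroʳ (p (F.suc i))))) ⟩
    𝟙 (p F.zero) + ∑[ i < n ] 0  ≡⟨ cong (𝟙 (p F.zero) +_) (sum-replicate-zero n) ⟩
    𝟙 (p F.zero) + 0             ≡⟨ +-identityʳ _ ⟩
    𝟙 (p F.zero)                 ∎
    where open ≡-Reasoning
  ∑𝟙-∧-≟ {suc n} p (F.suc j) =
    trans (cong (λ t → 𝟙 t + ∑[ i < n ] 𝟙 (p (F.suc i) ∧ does (i ≟ j))) (∧-zeroʳ (p F.zero)))
          (∑𝟙-∧-≟ (λ i → p (F.suc i)) j)

  ∑𝟙-remove : ∀ {n} (p : Fin n → Bool) (j : Fin n) →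
    ∑[ i < n ] 𝟙 (p i) ≡ 𝟙 (p j) + ∑[ i < n ] 𝟙 (p i ∧ not (does (i ≟ j)))
  ∑𝟙-remove {n} p j = trans (∑𝟙-split p (λ i → does (i ≟ j)))
    (cong (_+ ∑[ i < n ] 𝟙 (p i ∧ not (does (i ≟ j)))) (∑𝟙-∧-≟ p j))

  -- n₁ = k - λ - 1 and n₂ = v - k - 1, kept in ℕ without truncated subtraction.
  record SRGIdentities (v k l m : ℕ) : Set where
    field
      n₁ n₂      : ℕ
      k≡l+1+n₁  : k ≡ l + suc n₁
      v≡k+1+n₂  : v ≡ k + suc n₂
      k*n₁≡n₂*m : k * n₁ ≡ n₂ * m
      m≤k       : m ≤ k

  module _ {v} (G : Graph v) {k l m : ℕ} (srg : IsSRG G k l m) where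

    private
      deg : ∀ i → ∑[ z < v ] 𝟙 (adj G i z) ≡ k
      deg i = trans (sym (count≡∑𝟙 v (adj G i))) (proj₁ srg i)

      common-adj : ∀ i j → i ≢ j → adj G i j ≡ true → ∑[ z < v ] 𝟙 (adj G i z ∧ adj G j z) ≡ l
      common-adj i j i≢j ij = trans (sym (count≡∑𝟙 v _)) (proj₁ (proj₂ srg) i j i≢j ij)

      common-nonadj : ∀ i j → i ≢ j → adj G i j ≡ false → ∑[ z < v ] 𝟙 (adj G i z ∧ adj G j z) ≡ m
      common-nonadj i j i≢j ij = trans (sym (count≡∑𝟙 v _)) (proj₁ (proj₂ (proj₂ srg)) i j i≢j ij)

      srg-m≤k : m ≤ k
      srg-m≤k with proj₁ (proj₂ (proj₂ (proj₂ srg)))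
      ... | i , j , i≢j , ij = subst₂ _≤_ (common-nonadj i j i≢j ij) (deg i)
                                 (∑-mono (λ z → 𝟙-∧≤ (adj G i z) (adj G j z)))

      module Around (x : Fin v) where
        far : Fin v → Bool
        far z = not (adj G x z) ∧ not (does (z ≟ x))

        farDegree : Fin v → ℕ
        farDegree w = ∑[ z < v ] 𝟙 (adj G w z ∧ far z)

        v≡k+1+#far : v ≡ k + suc (∑[ z < v ] 𝟙 (far z))
        v≡k+1+#far = begin
          v                                                     ≡⟨ sym (∑𝟙-true v) ⟩
          ∑[ z < v ] 𝟙 true                                     ≡⟨ ∑𝟙-split (λ _ → true) (adj G x) ⟩
          ∑[ z < v ] 𝟙 (adj G x z) + ∑[ z < v ] 𝟙 (not (adj G x z))
            ≡⟨ cong₂ _+_ (deg x) (∑𝟙-remove (λ z → not (adj G x z)) x) ⟩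
          k + (𝟙 (not (adj G x x)) + ∑[ z < v ] 𝟙 (far z))
            ≡⟨ cong (λ b → k + (𝟙 (not b) + ∑[ z < v ] 𝟙 (far z))) (irrefl G x) ⟩
          k + suc (∑[ z < v ] 𝟙 (far z))                        ∎
          where open ≡-Reasoning

        k≡l+1+farDegree : ∀ w → adj G x w ≡ true → k ≡ l + suc (farDegree w)
        k≡l+1+farDegree w xw = begin
          k                                                 ≡⟨ sym (deg w) ⟩
          ∑[ z < v ] 𝟙 (adj G w z)                          ≡⟨ ∑𝟙-split (adj G w) (adj G x) ⟩
          ∑[ z < v ] 𝟙 (adj G w z ∧ adj G x z) + ∑[ z < v ] 𝟙 (outside z)
            ≡⟨ cong₂ _+_ (common-adj w x w≢x wx) (∑𝟙-remove outside x) ⟩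
          l + (𝟙 (adj G w x ∧ not (adj G x x)) + rest)
            ≡⟨ cong₂ (λ b c → l + (𝟙 (b ∧ not c) + rest)) wx (irrefl G x) ⟩
          l + suc rest
            ≡⟨ cong (λ t → l + suc t) (sum-cong-≗ (λ z → cong 𝟙 (∧-assoc (adj G w z) _ _))) ⟩
          l + suc (farDegree w)                             ∎
          where
          open ≡-Reasoning
          outside : Fin v → Bool
          outside z = adj G w z ∧ not (adj G x z)
          rest : ℕ
          rest = ∑[ z < v ] 𝟙 (outside z ∧ not (does (z ≟ x)))
          wx : adj G w x ≡ true
          wx = trans (Graph.sym G w x) xw
          w≢x : w ≢ x
          w≢x refl with trans (sym xw) (irrefl G w)
          ... | ()

        double-count : ∑[ w < v ] (𝟙 (adj G x w) * farDegree w) ≡ ∑[ z < v ] (𝟙 (far z) * m)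
        double-count = begin
          ∑[ w < v ] (𝟙 (adj G x w) * farDegree w)
            ≡⟨ sum-cong-≗ (λ w → *-distribˡ-sum (𝟙 (adj G x w)) (λ z → 𝟙 (adj G w z ∧ far z))) ⟩
          ∑[ w < v ] ∑[ z < v ] (𝟙 (adj G x w) * 𝟙 (adj G w z ∧ far z))
            ≡⟨ ∑-comm (λ w z → 𝟙 (adj G x w) * 𝟙 (adj G w z ∧ far z)) ⟩
          ∑[ z < v ] ∑[ w < v ] (𝟙 (adj G x w) * 𝟙 (adj G w z ∧ far z))
            ≡⟨ sum-cong-≗ (λ z → sum-cong-≗ (λ w → regroup z w)) ⟩
          ∑[ z < v ] ∑[ w < v ] (𝟙 (far z) * 𝟙 (adj G x w ∧ adj G z w))
            ≡⟨ sum-cong-≗ (λ z → sym (*-distribˡ-sum (𝟙 (far z)) (λ w → 𝟙 (adj G x w ∧ adj G z w)))) ⟩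
          ∑[ z < v ] (𝟙 (far z) * ∑[ w < v ] 𝟙 (adj G x w ∧ adj G z w))
            ≡⟨ sum-cong-≗ (λ z → 𝟙-*-cong (far z) (common-far z)) ⟩
          ∑[ z < v ] (𝟙 (far z) * m) ∎
          where
          open ≡-Reasoning
          regroup : ∀ z w → 𝟙 (adj G x w) * 𝟙 (adj G w z ∧ far z)
                          ≡ 𝟙 (far z) * 𝟙 (adj G x w ∧ adj G z w)
          regroup z w rewrite 𝟙-∧ (adj G w z) (far z) | 𝟙-∧ (adj G x w) (adj G z w) | Graph.sym G z w =
            trans (sym (*-assoc (𝟙 (adj G x w)) _ _)) (*-comm _ (𝟙 (far z)))
          common-far : ∀ z → far z ≡ true → ∑[ w < v ] 𝟙 (adj G x w ∧ adj G z w) ≡ m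
          common-far z fz with adj G x z in xz | does (z ≟ x) in zx
          common-far z () | true  | _
          common-far z () | false | true
          ... | false | false = common-nonadj x z x≢z xz
            where
            x≢z : x ≢ z
            x≢z x≡z with trans (sym (dec-true (z ≟ x) (sym x≡z))) zx
            ... | ()

    srg-identities : SRGIdentities v k l m
    srg-identities with proj₂ (proj₂ (proj₂ (proj₂ srg)))
    ... | x , y , xy = record
      { n₁ = farDegree y
      ; n₂ = ∑[ z < v ] 𝟙 (far z)
      ; k≡l+1+n₁ = k≡l+1+farDegree y xy
      ; v≡k+1+n₂ = v≡k+1+#far
      ; k*n₁≡n₂*m = edges
      ; m≤k = srg-m≤k
      }
      where
      open Around x
      open ≡-Reasoning
      farDegree≡ : ∀ w → adj G x w ≡ true → farDegree w ≡ farDegree y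
      farDegree≡ w xw = suc-injective (+-cancelˡ-≡ l _ _
        (trans (sym (k≡l+1+farDegree w xw)) (k≡l+1+farDegree y xy)))
      edges : k * farDegree y ≡ ∑[ z < v ] 𝟙 (far z) * m
      edges = begin
        k * farDegree y
          ≡⟨ cong (_* farDegree y) (sym (deg x)) ⟩
        ∑[ w < v ] 𝟙 (adj G x w) * farDegree y
          ≡⟨ *-distribʳ-sum (farDegree y) (λ w → 𝟙 (adj G x w)) ⟩
        ∑[ w < v ] (𝟙 (adj G x w) * farDegree y)
          ≡⟨ sum-cong-≗ (λ w → 𝟙-*-cong (adj G x w) (λ xw → sym (farDegree≡ w xw))) ⟩
        ∑[ w < v ] (𝟙 (adj G x w) * farDegree w)
          ≡⟨ double-count ⟩
        ∑[ z < v ] (𝟙 (far z) * m)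
          ≡⟨ sym (*-distribʳ-sum m (λ z → 𝟙 (far z))) ⟩
        ∑[ z < v ] 𝟙 (far z) * m ∎

module Surds where

  open import Defs hiding (sym)
  open import Data.Nat as ℕ using (ℕ; suc; z≤n)
  import Data.Nat.Properties as ℕP
  open import Data.Integer as ℤ using (ℤ; +_; -[1+_]; ∣_∣; _+_; _-_; _*_; -_; +≤+; +<+)
  import Data.Integer.Properties as ℤP
  open import Data.Sum using (inj₁; inj₂)
  open import Data.Product using (_,_; proj₂)
  open import Relation.Nullary using (Dec; yes; no; contradiction)
  open import Relation.Binary.PropositionalEquality
  open import Data.Nat.Tactic.RingSolver using (solve-∀)
  import Data.Integer.Tactic.RingSolver as ℤ-Solver

  sq-mono-≤ : ∀ {x y} → x ℕ.≤ y → x ℕ.* x ℕ.≤ y ℕ.* y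
  sq-mono-≤ x≤y = ℕP.*-mono-≤ x≤y x≤y

  sq-cancel-≤ : ∀ {x y} → x ℕ.* x ℕ.≤ y ℕ.* y → x ℕ.≤ y
  sq-cancel-≤ {x} {y} x²≤y² with x ℕ.≤? y
  ... | yes x≤y = x≤y
  ... | no  x≰y = contradiction x²≤y² (ℕP.<⇒≱ (ℕP.*-mono-< y<x y<x))
    where y<x = ℕP.≰⇒> x≰y

  -- u·u·δ₁ ≤ w·w·δ₂ encodes u√δ₁ ≤ w√δ₂.
  scaled-sq-cross : ∀ u p w q δ₁ δ₂ →
    w ℕ.* w ℕ.* δ₂ ℕ.≤ u ℕ.* u ℕ.* δ₁ → q ℕ.* q ℕ.* δ₂ ℕ.≤ p ℕ.* p ℕ.* δ₁ →
    w ℕ.* q ℕ.* δ₂ ℕ.≤ u ℕ.* p ℕ.* δ₁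
  scaled-sq-cross u p w q δ₁ δ₂ h₁ h₂ =
    sq-cancel-≤ (subst₂ ℕ._≤_ (regroup w q δ₂) (regroup u p δ₁) (ℕP.*-mono-≤ h₁ h₂))
    where
    regroup : ∀ a b c → a ℕ.* a ℕ.* c ℕ.* (b ℕ.* b ℕ.* c) ≡ a ℕ.* b ℕ.* c ℕ.* (a ℕ.* b ℕ.* c)
    regroup = solve-∀

  scaled-sq-cancelʳ-+ : ∀ u p w q δ₁ δ₂ →
    (u ℕ.+ p) ℕ.* (u ℕ.+ p) ℕ.* δ₁ ℕ.≤ (w ℕ.+ q) ℕ.* (w ℕ.+ q) ℕ.* δ₂ →
    q ℕ.* q ℕ.* δ₂ ℕ.≤ p ℕ.* p ℕ.* δ₁ →
    u ℕ.* u ℕ.* δ₁ ℕ.≤ w ℕ.* w ℕ.* δ₂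
  scaled-sq-cancelʳ-+ u p w q δ₁ δ₂ h₁ h₂ with u ℕ.* u ℕ.* δ₁ ℕ.≤? w ℕ.* w ℕ.* δ₂
  ... | yes u≤w = u≤w
  ... | no  u≰w = contradiction h₁ (ℕP.<⇒≱ (subst₂ ℕ._<_ (expand w q δ₂) (expand u p δ₁)
          (ℕP.+-mono-<-≤ (ℕP.+-mono-<-≤ w<u (ℕP.*-monoʳ-≤ 2 cross)) h₂)))
    where
    w<u = ℕP.≰⇒> u≰w
    cross = scaled-sq-cross u p w q δ₁ δ₂ (ℕP.<⇒≤ w<u) h₂
    expand : ∀ a b c → a ℕ.* a ℕ.* c ℕ.+ 2 ℕ.* (a ℕ.* b ℕ.* c) ℕ.+ b ℕ.* b ℕ.* c
                     ≡ (a ℕ.+ b) ℕ.* (a ℕ.+ b) ℕ.* c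
    expand = solve-∀

  pos-∸ : ∀ {m n} → n ℕ.≤ m → + m - + n ≡ + (m ℕ.∸ n)
  pos-∸ {m} {n} n≤m = trans (ℤP.[+m]-[+n]≡m⊖n m n) (ℤP.⊖-≥ n≤m)

  ≡pos⇒0≤ : ∀ {i n} → i ≡ + n → + 0 ℤ.≤ i
  ≡pos⇒0≤ refl = +≤+ z≤n

  0≤m-n : ∀ {m n} → n ℕ.≤ m → + 0 ℤ.≤ + m - + n
  0≤m-n n≤m = ≡pos⇒0≤ (pos-∸ n≤m)

  0≤* : ∀ {i j} → + 0 ℤ.≤ i → + 0 ℤ.≤ j → + 0 ℤ.≤ i * j
  0≤* {+ a} {+ b} _ _ = ≡pos⇒0≤ (sym (ℤP.pos-* a b))

  i≤+∣i∣ : ∀ i → i ℤ.≤ + ∣ i ∣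
  i≤+∣i∣ (+ n)    = ℤP.≤-refl
  i≤+∣i∣ -[1+ n ] = ℤ.-≤+

  sq≡ : ∀ i → i * i ≡ + (∣ i ∣ ℕ.* ∣ i ∣)
  sq≡ (+ n)    = sym (ℤP.pos-* n n)
  sq≡ -[1+ n ] = refl

  sq*≡ : ∀ i δ → i * i * + δ ≡ + (∣ i ∣ ℕ.* ∣ i ∣ ℕ.* δ)
  sq*≡ i δ = trans (cong (_* + δ) (sq≡ i)) (sym (ℤP.pos-* (∣ i ∣ ℕ.* ∣ i ∣) δ))

  sq≤sq*⇒ : ∀ i j {δ} → i * i ℤ.≤ j * j * + δ →
            ∣ i ∣ ℕ.* ∣ i ∣ ℕ.≤ ∣ j ∣ ℕ.* ∣ j ∣ ℕ.* δ
  sq≤sq*⇒ i j {δ} h = ℤP.drop‿+≤+ (subst₂ ℤ._≤_ (sq≡ i) (sq*≡ j δ) h)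

  sq≤sq*⇐ : ∀ i j {δ} → ∣ i ∣ ℕ.* ∣ i ∣ ℕ.≤ ∣ j ∣ ℕ.* ∣ j ∣ ℕ.* δ →
            i * i ℤ.≤ j * j * + δ
  sq≤sq*⇐ i j {δ} h = subst₂ ℤ._≤_ (sym (sq≡ i)) (sym (sq*≡ j δ)) (+≤+ h)

  sq*≤sq⇒ : ∀ i j {δ} → j * j * + δ ℤ.≤ i * i →
            ∣ j ∣ ℕ.* ∣ j ∣ ℕ.* δ ℕ.≤ ∣ i ∣ ℕ.* ∣ i ∣
  sq*≤sq⇒ i j {δ} h = ℤP.drop‿+≤+ (subst₂ ℤ._≤_ (sq*≡ j δ) (sq≡ i) h)

  sq*≤sq⇐ : ∀ i j {δ} → ∣ j ∣ ℕ.* ∣ j ∣ ℕ.* δ ℕ.≤ ∣ i ∣ ℕ.* ∣ i ∣ →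
            j * j * + δ ℤ.≤ i * i
  sq*≤sq⇐ i j {δ} h = subst₂ ℤ._≤_ (sym (sq*≡ j δ)) (sym (sq≡ i)) (+≤+ h)

  0≤+-shift : ∀ {i} c → + 0 ℤ.≤ i → + 0 ℤ.≤ i + + c
  0≤+-shift c (+≤+ z≤n) = +≤+ z≤n

  ∣∣-shift-mono : ∀ {i} c → + 0 ℤ.≤ i → ∣ i ∣ ℕ.≤ ∣ i + + c ∣
  ∣∣-shift-mono {+ n} c _ = ℕP.m≤m+n n c

  ∣∣-shift-neg : ∀ i c → i + + c ℤ.< + 0 → ∣ i ∣ ≡ ∣ i + + c ∣ ℕ.+ c
  ∣∣-shift-neg (+ n)    c (+<+ ())
  ∣∣-shift-neg -[1+ n ] c i+c<0 with c ℕ.<? suc n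
  ... | yes c<n = trans (sym (ℕP.m∸n+n≡m (ℕP.<⇒≤ c<n))) (cong (ℕ._+ c) (sym (ℤP.∣⊖∣-< c<n)))
  ... | no  c≮n = contradiction i+c<0
                    (ℤP.≤⇒≯ (≡pos⇒0≤ (ℤP.⊖-≥ (ℕP.≮⇒≥ c≮n))))

  shift-neg≡ : ∀ i c → i ℤ.< + 0 → ∣ i ∣ ℕ.≤ c → i + + c ≡ + (c ℕ.∸ ∣ i ∣)
  shift-neg≡ (+ n)    c (+<+ ())
  shift-neg≡ -[1+ n ] c _ n<c = ℤP.⊖-≥ n<c

  nonNeg-+ : ∀ {D a b} → + 0 ℤ.≤ D → ∀ c e → NonNeg D (a , b) → NonNeg D (a + + c , b + + e)
  nonNeg-+ (+≤+ z≤n) = nonNeg-+ℕ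
    where
    nonNeg-+ℕ : ∀ {δ a b} c e → NonNeg (+ δ) (a , b) → NonNeg (+ δ) (a + + c , b + + e)
    nonNeg-+ℕ c e (inj₁ (0≤a , 0≤b)) = inj₁ (0≤+-shift c 0≤a , 0≤+-shift e 0≤b)
    nonNeg-+ℕ {δ} {a} {b} c e (inj₂ (inj₁ (0≤a , b<0 , b²δ≤a²))) with + 0 ℤ.≤? b + + e
    ... | yes 0≤b+e = inj₁ (0≤+-shift c 0≤a , 0≤b+e)
    ... | no  b+e<0 = inj₂ (inj₁ (0≤+-shift c 0≤a , ℤP.≰⇒> b+e<0 , sq*≤sq⇐ (a + + c) (b + + e) (begin
      ∣ b + + e ∣ ℕ.* ∣ b + + e ∣ ℕ.* δ  ≤⟨ ℕP.*-monoˡ-≤ δ (sq-mono-≤ ∣b+e∣≤∣b∣) ⟩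
      ∣ b ∣ ℕ.* ∣ b ∣ ℕ.* δ              ≤⟨ sq*≤sq⇒ a b b²δ≤a² ⟩
      ∣ a ∣ ℕ.* ∣ a ∣                    ≤⟨ sq-mono-≤ (∣∣-shift-mono c 0≤a) ⟩
      ∣ a + + c ∣ ℕ.* ∣ a + + c ∣        ∎)))
      where
      open ℕP.≤-Reasoning
      ∣b+e∣≤∣b∣ = subst (∣ b + + e ∣ ℕ.≤_) (sym (∣∣-shift-neg b e (ℤP.≰⇒> b+e<0)))
                  (ℕP.m≤m+n _ e)
    nonNeg-+ℕ {δ} {a} {b} c e (inj₂ (inj₂ (a<0 , 0≤b , a²≤b²δ))) with + 0 ℤ.≤? a + + c
    ... | yes 0≤a+c = inj₁ (0≤a+c , 0≤+-shift e 0≤b)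
    ... | no  a+c<0 = inj₂ (inj₂ (ℤP.≰⇒> a+c<0 , 0≤+-shift e 0≤b , sq≤sq*⇐ (a + + c) (b + + e) (begin
      ∣ a + + c ∣ ℕ.* ∣ a + + c ∣        ≤⟨ sq-mono-≤ ∣a+c∣≤∣a∣ ⟩
      ∣ a ∣ ℕ.* ∣ a ∣                    ≤⟨ sq≤sq*⇒ a b a²≤b²δ ⟩
      ∣ b ∣ ℕ.* ∣ b ∣ ℕ.* δ              ≤⟨ ℕP.*-monoˡ-≤ δ (sq-mono-≤ (∣∣-shift-mono e 0≤b)) ⟩
      ∣ b + + e ∣ ℕ.* ∣ b + + e ∣ ℕ.* δ  ∎)))
      where
      open ℕP.≤-Reasoning
      ∣a+c∣≤∣a∣ = subst (∣ a + + c ∣ ℕ.≤_) (sym (∣∣-shift-neg a c (ℤP.≰⇒> a+c<0)))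
                  (ℕP.m≤m+n _ c)

  nonNeg⇒sq≤ : ∀ {δ a} α → NonNeg (+ δ) (a , + α) → a ℤ.< + 0 →
               ∣ a ∣ ℕ.* ∣ a ∣ ℕ.≤ α ℕ.* α ℕ.* δ
  nonNeg⇒sq≤ α (inj₁ (0≤a , _)) a<0 = contradiction a<0 (ℤP.≤⇒≯ 0≤a)
  nonNeg⇒sq≤ α (inj₂ (inj₁ (_ , +<+ () , _)))
  nonNeg⇒sq≤ {a = a} α (inj₂ (inj₂ (_ , _ , a²≤α²δ))) _ = sq≤sq*⇒ a (+ α) a²≤α²δ

  nonNeg-+-sub-≤ : ∀ {δ a} α p ι → ι ℕ.≤ α → ι ℕ.* ι ℕ.* δ ℕ.≤ p ℕ.* p →
                   NonNeg (+ δ) (a , + α) → NonNeg (+ δ) (a + + p , + (α ℕ.∸ ι))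
  nonNeg-+-sub-≤ {δ} {a} α p ι ι≤α ι²δ≤p² nn with + 0 ℤ.≤? a + + p
  ... | yes 0≤a+p = inj₁ (0≤a+p , +≤+ z≤n)
  ... | no  a+p≱0 = inj₂ (inj₂ (a+p<0 , +≤+ z≤n , sq≤sq*⇐ (a + + p) (+ w) u²≤w²δ))
    where
    a+p<0 = ℤP.≰⇒> a+p≱0
    u = ∣ a + + p ∣
    w = α ℕ.∸ ι
    a²≤α²δ : ∣ a ∣ ℕ.* ∣ a ∣ ℕ.* 1 ℕ.≤ α ℕ.* α ℕ.* δ
    a²≤α²δ = subst (ℕ._≤ α ℕ.* α ℕ.* δ) (sym (ℕP.*-identityʳ _))
               (nonNeg⇒sq≤ α nn (ℤP.≤-<-trans (ℤP.i≤i+j a (+ p)) a+p<0))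
    u²≤w²δ : u ℕ.* u ℕ.≤ w ℕ.* w ℕ.* δ
    u²≤w²δ = subst (ℕ._≤ w ℕ.* w ℕ.* δ) (ℕP.*-identityʳ (u ℕ.* u))
      (scaled-sq-cancelʳ-+ u p w ι 1 δ
        (subst₂ (λ x y → x ℕ.* x ℕ.* 1 ℕ.≤ y ℕ.* y ℕ.* δ)
                (∣∣-shift-neg a p a+p<0) (sym (ℕP.m∸n+n≡m ι≤α)) a²≤α²δ)
        (subst (ι ℕ.* ι ℕ.* δ ℕ.≤_) (sym (ℕP.*-identityʳ _)) ι²δ≤p²))

  nonNeg-+-sub-> : ∀ {δ a} α p ι → α ℕ.< ι → ι ℕ.* ι ℕ.* δ ℕ.≤ p ℕ.* p →
                   NonNeg (+ δ) (a , + α) → NonNeg (+ δ) (a + + p , - + (ι ℕ.∸ α))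
  nonNeg-+-sub-> {δ} {a} α p ι α<ι ι²δ≤p² nn = flipped (+ 0 ℤ.≤? a)
    where
    t = ι ℕ.∸ α
    -t<0 : - + t ℤ.< + 0
    -t<0 = ℤP.neg-mono-< (+<+ (ℕP.m<n⇒0<n∸m α<ι))
    case₂ : ∀ X → t ℕ.* t ℕ.* δ ℕ.≤ X ℕ.* X → a + + p ≡ + X → NonNeg (+ δ) (a + + p , - + t)
    case₂ X t²δ≤X² a+p≡X = inj₂ (inj₁ (≡pos⇒0≤ a+p≡X , -t<0 ,
      sq*≤sq⇐ (a + + p) (- + t)
        (subst₂ (λ y x → y ℕ.* y ℕ.* δ ℕ.≤ x ℕ.* x) (sym (ℤP.∣-i∣≡∣i∣ (+ t))) (cong ∣_∣ (sym a+p≡X))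
                t²δ≤X²)))
    flipped : Dec (+ 0 ℤ.≤ a) → NonNeg (+ δ) (a + + p , - + t)
    flipped (yes (+≤+ {n = n} z≤n)) = case₂ (n ℕ.+ p) (begin
      t ℕ.* t ℕ.* δ             ≤⟨ ℕP.*-monoˡ-≤ δ (sq-mono-≤ (ℕP.m∸n≤m ι α)) ⟩
      ι ℕ.* ι ℕ.* δ             ≤⟨ ι²δ≤p² ⟩
      p ℕ.* p                   ≤⟨ sq-mono-≤ (ℕP.m≤n+m p n) ⟩
      (n ℕ.+ p) ℕ.* (n ℕ.+ p)   ∎) refl
      where open ℕP.≤-Reasoning
    flipped (no a≱0) = case₂ (p ℕ.∸ ∣ a ∣) t²δ≤X² (shift-neg≡ a p a<0 ∣a∣≤p)
      where
      a<0 = ℤP.≰⇒> a≱0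
      a²≤α²δ = nonNeg⇒sq≤ α nn a<0
      ∣a∣≤p : ∣ a ∣ ℕ.≤ p
      ∣a∣≤p = sq-cancel-≤ (ℕP.≤-trans a²≤α²δ
                (ℕP.≤-trans (ℕP.*-monoˡ-≤ δ (sq-mono-≤ (ℕP.<⇒≤ α<ι))) ι²δ≤p²))
      t²δ≤X² : t ℕ.* t ℕ.* δ ℕ.≤ (p ℕ.∸ ∣ a ∣) ℕ.* (p ℕ.∸ ∣ a ∣)
      t²δ≤X² = subst (t ℕ.* t ℕ.* δ ℕ.≤_) (ℕP.*-identityʳ _)
        (scaled-sq-cancelʳ-+ t α (p ℕ.∸ ∣ a ∣) ∣ a ∣ δ 1
          (subst₂ (λ y x → y ℕ.* y ℕ.* δ ℕ.≤ x ℕ.* x ℕ.* 1) (sym (ℕP.m∸n+n≡m (ℕP.<⇒≤ α<ι)))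
            (sym (ℕP.m∸n+n≡m ∣a∣≤p))
            (subst (ι ℕ.* ι ℕ.* δ ℕ.≤_) (sym (ℕP.*-identityʳ _)) ι²δ≤p²))
          (subst (ℕ._≤ α ℕ.* α ℕ.* δ) (sym (ℕP.*-identityʳ _)) a²≤α²δ))

  nonNeg-+-sub : ∀ {δ a} α p ι → ι ℕ.* ι ℕ.* δ ℕ.≤ p ℕ.* p → NonNeg (+ δ) (a , + α) →
                 NonNeg (+ δ) (a + + p , + α - + ι)
  nonNeg-+-sub {δ} {a} α p ι ι²δ≤p² nn with ι ℕ.≤? α
  ... | yes ι≤α = subst (λ b → NonNeg (+ δ) (a + + p , b)) (sym (pos-∸ ι≤α))
                    (nonNeg-+-sub-≤ α p ι ι≤α ι²δ≤p² nn)
  ... | no  ι≰α = subst (λ b → NonNeg (+ δ) (a + + p , b))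
                    (sym (trans (ℤP.[+m]-[+n]≡m⊖n α ι) (ℤP.⊖-< (ℕP.≰⇒> ι≰α))))
                    (nonNeg-+-sub-> α p ι (ℕP.≰⇒> ι≰α) ι²δ≤p² nn)

  nonNeg-of-sq≤ : ∀ {D a b} → + 0 ℤ.≤ b → a * a ℤ.≤ b * b * D → NonNeg D (a , b)
  nonNeg-of-sq≤ {a = a} 0≤b a²≤b²D with + 0 ℤ.≤? a
  ... | yes 0≤a = inj₁ (0≤a , 0≤b)
  ... | no  a≱0 = inj₂ (inj₂ (ℤP.≰⇒> a≱0 , 0≤b , a²≤b²D))


  ≤[]-downward : ∀ {D γ num i j} → + 0 ℤ.≤ D → j ℤ.≤ i →
    sMul D (ofℤ i) (+ γ , + 1) ≤[ D ] num → sMul D (ofℤ j) (+ γ , + 1) ≤[ D ] num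
  ≤[]-downward {D} {γ} {p , q} {i} {j} 0≤D j≤i i-below =
    subst (NonNeg D) shifted≡ (nonNeg-+ 0≤D (ι ℕ.* γ) ι i-below)
    where
    ι = ∣ i - j ∣
    ι≡i-j : + ι ≡ i - j
    ι≡i-j = ℤP.0≤i⇒+∣i∣≡i (ℤP.i≤j⇒0≤j-i j≤i)
    first : ∀ p i j g → p + - (i * g + + 0) + (i - j) * g ≡ p + - (j * g + + 0)
    first = ℤ-Solver.solve-∀
    second : ∀ q i j → q + - (i * + 1 + + 0) + (i - j) ≡ q + - (j * + 1 + + 0)
    second = ℤ-Solver.solve-∀
    shifted≡ : (p + - (i * + γ + + 0) + + (ι ℕ.* γ) , q + - (i * + 1 + + 0) + + ι)
             ≡ sAdd (p , q) (sNeg (sMul D (ofℤ j) (+ γ , + 1)))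
    shifted≡ = cong₂ _,_
      (trans (cong (λ t → p + - (i * + γ + + 0) + t) (trans (ℤP.pos-* ι γ) (cong (_* + γ) ι≡i-j)))
             (first p i j (+ γ)))
      (trans (cong (λ t → q + - (i * + 1 + + 0) + t) ι≡i-j) (second q i j))

  ≤[]-upward : ∀ {D γ num i j} → + 0 ℤ.≤ D → D ℤ.≤ + γ * + γ → i ℤ.≤ j →
    + 0 ℤ.≤ proj₂ (sAdd (sMul D (ofℤ i) (+ γ , - + 1)) (sNeg num)) →
    num ≤[ D ] sMul D (ofℤ i) (+ γ , - + 1) → num ≤[ D ] sMul D (ofℤ j) (+ γ , - + 1)
  ≤[]-upward {+ δ} {γ} {p , q} {i} {j} (+≤+ z≤n) δ≤γ² i≤j 0≤b i-above =
    subst (NonNeg (+ δ)) shifted≡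
      (nonNeg-+-sub ∣ b ∣ (ι ℕ.* γ) ι ι²δ≤[ιγ]²
        (subst (λ t → NonNeg (+ δ) (a , t)) (sym ∣b∣≡b) i-above))
    where
    a = i * + γ + + 0 + - p
    b = i * - + 1 + + 0 + - q
    ∣b∣≡b : + ∣ b ∣ ≡ b
    ∣b∣≡b = ℤP.0≤i⇒+∣i∣≡i 0≤b
    ι = ∣ j - i ∣
    ι≡j-i : + ι ≡ j - i
    ι≡j-i = ℤP.0≤i⇒+∣i∣≡i (ℤP.i≤j⇒0≤j-i i≤j)
    ι²δ≤[ιγ]² : ι ℕ.* ι ℕ.* δ ℕ.≤ ι ℕ.* γ ℕ.* (ι ℕ.* γ)
    ι²δ≤[ιγ]² = subst (ι ℕ.* ι ℕ.* δ ℕ.≤_) (regroup ι γ)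
      (ℕP.*-monoʳ-≤ (ι ℕ.* ι) (ℤP.drop‿+≤+ (subst (+ δ ℤ.≤_) (sym (ℤP.pos-* γ γ)) δ≤γ²)))
      where
      regroup : ∀ x y → x ℕ.* x ℕ.* (y ℕ.* y) ≡ x ℕ.* y ℕ.* (x ℕ.* y)
      regroup = solve-∀
    first : ∀ p i j g → i * g + + 0 + - p + (j - i) * g ≡ j * g + + 0 + - p
    first = ℤ-Solver.solve-∀
    second : ∀ q i j → i * - + 1 + + 0 + - q - (j - i) ≡ j * - + 1 + + 0 + - q
    second = ℤ-Solver.solve-∀
    shifted≡ : (a + + (ι ℕ.* γ) , + ∣ b ∣ - + ι) ≡ sAdd (sMul (+ δ) (ofℤ j) (+ γ , - + 1)) (sNeg (p , q))
    shifted≡ = cong₂ _,_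
      (trans (cong (λ t → a + t) (trans (ℤP.pos-* ι γ) (cong (_* + γ) ι≡j-i))) (first p i j (+ γ)))
      (trans (cong₂ _-_ ∣b∣≡b ι≡j-i) (second q i j))

  floor-maximal : ∀ {D num den n} y → (∀ j → j ℤ.≤ y → sMul D (ofℤ j) den ≤[ D ] num) →
                  IsFloorFrac D num den n → y ℤ.≤ n
  floor-maximal {n = n} y below (_ , n+1-above) with y ℤ.≤? n
  ... | yes y≤n = y≤n
  ... | no  y≰n = contradiction (below (n + + 1) n+1≤y) n+1-above
    where
    n+1≤y : n + + 1 ℤ.≤ y
    n+1≤y = subst (ℤ._≤ y) (ℤP.+-comm (+ 1) n) (ℤP.i<j⇒suc[i]≤j (ℤP.≰⇒> y≰n))

  ceil-minimal : ∀ {D num den n} y → (∀ j → y ℤ.≤ j → num ≤[ D ] sMul D (ofℤ j) den) →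
                 IsCeilFrac D num den n → n ℤ.≤ y
  ceil-minimal {n = n} y above (n-1-below , _) with n ℤ.≤? y
  ... | yes n≤y = n≤y
  ... | no  n≰y = contradiction (above (n - + 1) y≤n-1) n-1-below
    where
    y≤n-1 : y ℤ.≤ n - + 1
    y≤n-1 = subst (y ℤ.≤_) (ℤP.+-comm -[1+ 0 ] n) (ℤP.i<j⇒i≤pred[j] (ℤP.≰⇒> n≰y))

module RestrictedEigenvalues where

  open import Defs hiding (sym)
  open Counting using (SRGIdentities)
  open Surds using (pos-∸; 0≤m-n; 0≤*; i≤+∣i∣)
  open import Data.Nat as ℕ using (ℕ; zero; suc; z≤n; s≤s)
  import Data.Nat.Properties as ℕP
  open import Data.Nat.DivMod using (_/_; _%_; m≡m%n+[m/n]*n; m%n<n)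
  open import Data.Integer as ℤ using (ℤ; +_; ∣_∣; _+_; _-_; _*_; -_; +≤+)
  import Data.Integer.Properties as ℤP
  open import Data.Integer.Tactic.RingSolver using (solve-∀)
  open import Relation.Nullary using (contradiction)
  open import Relation.Binary.PropositionalEquality

  -- The ring solver does not unfold SRGParams.R, so the identities involving R are stated with its
  -- body written out (for x and for 0) and with the parameters as variables.
  R-expand : ∀ V K L M x y d →
    x * (x + + 1) * (V - y) - + 2 * x * y * K + (+ 2 * x + L + + 1) * y * d + y * (y - + 1) * M - y * d * d
    ≡ + 0 * (+ 0 + + 1) * (V - y) - + 2 * + 0 * y * K + (+ 2 * + 0 + L + + 1) * y * d
      + y * (y - + 1) * M - y * d * d + x * ((x + + 1) * (V - y) - + 2 * (y * (K - d)))
  R-expand = solve-∀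

  completed-square-eigenForm : ∀ V K l M y d →
    V * ((V - y) * (+ 0 * (+ 0 + + 1) * (V - y) - + 2 * + 0 * y * K + (+ 2 * + 0 + (l - M) + + 1) * y * d
           + y * (y - + 1) * M - y * d * d + y * (K - d)) - y * (K - d) * (y * (K - d)))
    ≡ - (y * ((V * d - y * K) * (V * d - y * K) - (l - M) * (V * d - y * K) * (V - y)
              - (K - M) * (V - y) * (V - y)))
      - y * y * (V - y) * (K * (K - l - + 1) - (V - K - + 1) * M)
  completed-square-eigenForm = solve-∀

  -- w² times the characteristic polynomial t² - L t - c of the restricted eigenvalues, at t = s/w.
  eigenForm : (L c s w : ℤ) → ℤ
  eigenForm L c s w = s * s - L * s * w - c * w * w

  discriminant-eigenForm : ∀ L c s w →
    w * w * (L * L + + 4 * c) - (+ 2 * s - L * w) * (+ 2 * s - L * w) ≡ + 4 * - eigenForm L c s w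
  discriminant-eigenForm = identity
    where
    identity : ∀ L c s w → w * w * (L * L + + 4 * c) - (+ 2 * s - L * w) * (+ 2 * s - L * w)
                         ≡ + 4 * - (s * s - L * s * w - c * w * w)
    identity = solve-∀

  m-n*[m/n]≡m%n : ∀ m n .{{_ : ℕ.NonZero n}} → + m - + n * + (m / n) ≡ + (m % n)
  m-n*[m/n]≡m%n m n = begin
    + m - + n * + (m / n)                      ≡⟨ cong (λ t → + t - + n * + (m / n)) (m≡m%n+[m/n]*n m n) ⟩
    + (m % n ℕ.+ m / n ℕ.* n) - + n * + (m / n) ≡⟨ cong (_- + n * + (m / n))
                                                    (trans (ℤP.pos-+ (m % n) (m / n ℕ.* n))
                                                           (cong (λ t → + (m % n) + t) (ℤP.pos-* (m / n) n))) ⟩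
    + (m % n) + + (m / n) * + n - + n * + (m / n) ≡⟨ cancel (+ (m % n)) (+ (m / n)) (+ n) ⟩
    + (m % n)                                   ∎
    where
    open ≡-Reasoning
    cancel : ∀ a b c → a + b * c - c * b ≡ a
    cancel = solve-∀

  -- At the integer x = ⌊e/α⌋ the remainder q = e - αx lies in [0, α], so q(α - q) ≥ 0.
  completed-square-nonneg : ∀ α e r₀ .{{_ : ℕ.NonZero α}} →
    (∀ x → + 0 ℤ.≤ r₀ + x * ((x + + 1) * + α - + 2 * + e)) → + 0 ℤ.≤ + α * (r₀ + + e) - + e * + e
  completed-square-nonneg α e r₀ Q≥0 = subst (+ 0 ℤ.≤_) (sym W≡)
    (ℤP.+-mono-≤ (0≤* {+ α} (+≤+ z≤n) (Q≥0 (+ x)))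
                 (0≤* {+ q} (+≤+ z≤n) (0≤m-n (ℕP.<⇒≤ (m%n<n e α)))))
    where
    x = e / α
    q = e % α
    identity : ∀ α e r₀ x →
      α * (r₀ + e) - e * e ≡ α * (r₀ + x * ((x + + 1) * α - + 2 * e)) + (e - α * x) * (α - (e - α * x))
    identity = solve-∀
    W≡ : + α * (r₀ + + e) - + e * + e ≡ + α * (r₀ + + x * ((+ x + + 1) * + α - + 2 * + e)) + + q * (+ α - + q)
    W≡ = trans (identity (+ α) (+ e) r₀ (+ x))
               (cong (λ t → + α * (r₀ + + x * ((+ x + + 1) * + α - + 2 * + e)) + t * (+ α - t))
                     (m-n*[m/n]≡m%n e α))

  bounded-below-linear⇒0 : ∀ c e → (∀ x → + 0 ℤ.≤ c - x * + e) → e ≡ 0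
  bounded-below-linear⇒0 c zero    _   = refl
  bounded-below-linear⇒0 c (suc e) c≥x = contradiction (ℤP.drop‿+≤+ (begin
    + suc ∣ c ∣              ≤⟨ +≤+ (ℕP.m≤m*n (suc ∣ c ∣) (suc e)) ⟩
    + (suc ∣ c ∣ ℕ.* suc e)  ≡⟨ ℤP.pos-* (suc ∣ c ∣) (suc e) ⟩
    + suc ∣ c ∣ * + suc e    ≤⟨ ℤP.0≤i-j⇒j≤i (c≥x (+ suc ∣ c ∣)) ⟩
    c                        ≤⟨ i≤+∣i∣ c ⟩
    + ∣ c ∣                  ∎)) (ℕP.n≮n ∣ c ∣)
    where open ℤP.≤-Reasoning

  module BetweenEigenvalues {v k l m} (ids : SRGIdentities v k l m) where
    open SRGParams v k l m
    open SRGIdentities ids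

    completedSquare : ℕ → ℕ → ℤ
    completedSquare d y = (+ v - + y) * (R (+ 0) (+ y) (+ d) + + y * (+ k - + d))
                        - + y * (+ k - + d) * (+ y * (+ k - + d))

    completedSquare-nonneg : ∀ {d y} → d ℕ.≤ k → y ℕ.< v → (∀ x → + 0 ℤ.≤ R x (+ y) (+ d)) →
                             + 0 ℤ.≤ completedSquare d y
    completedSquare-nonneg {d} {y} d≤k y<v R≥0 = subst (+ 0 ℤ.≤_) (sym W≡)
      (completed-square-nonneg α e r₀ (λ x → subst (+ 0 ℤ.≤_) (Rx≡ x) (R≥0 x)))
      where
      α = v ℕ.∸ y
      instance
        α≢0 : ℕ.NonZero α
        α≢0 = ℕ.>-nonZero (ℕP.m<n⇒0<n∸m y<v)
      e = y ℕ.* (k ℕ.∸ d)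
      r₀ = R (+ 0) (+ y) (+ d)
      v-y≡α : + v - + y ≡ + α
      v-y≡α = pos-∸ (ℕP.<⇒≤ y<v)
      y[k-d]≡e : + y * (+ k - + d) ≡ + e
      y[k-d]≡e = trans (cong (+ y *_) (pos-∸ d≤k)) (sym (ℤP.pos-* y (k ℕ.∸ d)))
      Rx≡ : ∀ x → R x (+ y) (+ d) ≡ r₀ + x * ((x + + 1) * + α - + 2 * + e)
      Rx≡ x = trans (R-expand (+ v) (+ k) L (+ m) x (+ y) (+ d))
                    (cong₂ (λ a b → r₀ + x * ((x + + 1) * a - + 2 * b)) v-y≡α y[k-d]≡e)
      W≡ : completedSquare d y ≡ + α * (r₀ + + e) - + e * + e
      W≡ = cong₂ (λ a b → a * (r₀ + b) - b * b) v-y≡α y[k-d]≡e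

    k[k-l-1]-[v-k-1]m≡0 : + k * (+ k - + l - + 1) - (+ v - + k - + 1) * + m ≡ + 0
    k[k-l-1]-[v-k-1]m≡0 = begin
      + k * (+ k - + l - + 1) - (+ v - + k - + 1) * + m
        ≡⟨ cong₂ (λ a b → + k * a - b * + m) (pos-[a+1+c]-a-1 k≡l+1+n₁) (pos-[a+1+c]-a-1 v≡k+1+n₂) ⟩
      + k * + n₁ - + n₂ * + m          ≡⟨ cong₂ _-_ (sym (ℤP.pos-* k n₁)) (sym (ℤP.pos-* n₂ m)) ⟩
      + (k ℕ.* n₁) - + (n₂ ℕ.* m)      ≡⟨ cong (λ t → + (k ℕ.* n₁) - + t) (sym k*n₁≡n₂*m) ⟩
      + (k ℕ.* n₁) - + (k ℕ.* n₁)      ≡⟨ ℤP.+-inverseʳ (+ (k ℕ.* n₁)) ⟩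
      + 0                              ∎
      where
      open ≡-Reasoning
      cancel : ∀ i j → i + (+ 1 + j) - i - + 1 ≡ j
      cancel = solve-∀
      pos-[a+1+c]-a-1 : ∀ {a b c} → a ≡ b ℕ.+ suc c → + a - + b - + 1 ≡ + c
      pos-[a+1+c]-a-1 {b = b} {c} refl = trans (cong (λ t → t - + b - + 1) (ℤP.pos-+ b (suc c))) (cancel (+ b) (+ c))

    slope : ℕ → ℕ → ℤ
    slope d y = + v * + d - + y * + k

    eigenForm-nonpos : ∀ {d y} → d ℕ.≤ k → d ℕ.< y → y ℕ.< v → (∀ x → + 0 ℤ.≤ R x (+ y) (+ d)) →
                       eigenForm L (+ k - + m) (slope d y) (+ v - + y) ℤ.≤ + 0
    eigenForm-nonpos {d} {y@(suc _)} d≤k d<y y<v R≥0 = ℤP.*-cancelˡ-≤-pos _ (+ 0) (+ y) (ℤP.neg-cancel-≤ (begin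
      - (+ y * + 0)                               ≡⟨ cong -_ (ℤP.*-zeroʳ (+ y)) ⟩
      + 0                                         ≤⟨ 0≤* {+ v} (+≤+ z≤n) (completedSquare-nonneg d≤k y<v R≥0) ⟩
      + v * completedSquare d y                   ≡⟨ completed-square-eigenForm (+ v) (+ k) (+ l) (+ m) (+ y) (+ d) ⟩
      - (+ y * E) - + y * + y * (+ v - + y) * defect ≡⟨ cong (λ t → - (+ y * E) - + y * + y * (+ v - + y) * t)
                                                         k[k-l-1]-[v-k-1]m≡0 ⟩
      - (+ y * E) - + y * + y * (+ v - + y) * + 0 ≡⟨ drop-zero (- (+ y * E)) (+ y * + y * (+ v - + y)) ⟩
      - (+ y * E)                                 ∎))
      where
      open ℤP.≤-Reasoning
      E = eigenForm L (+ k - + m) (slope d y) (+ v - + y)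
      defect = + k * (+ k - + l - + 1) - (+ v - + k - + 1) * + m
      drop-zero : ∀ a b → a - b * + 0 ≡ a
      drop-zero = solve-∀

    gap : ℕ → ℕ → ℤ
    gap d y = + 2 * slope d y - L * (+ v - + y)

    gap²≤ : ∀ {d y} → d ℕ.≤ k → d ℕ.< y → y ℕ.< v → (∀ x → + 0 ℤ.≤ R x (+ y) (+ d)) →
            gap d y * gap d y ℤ.≤ (+ v - + y) * (+ v - + y) * Δ
    gap²≤ {d} {y} d≤k d<y y<v R≥0 = ℤP.0≤i-j⇒j≤i (subst (+ 0 ℤ.≤_)
      (sym (discriminant-eigenForm L (+ k - + m) (slope d y) (+ v - + y)))
      (0≤* {+ 4} (+≤+ z≤n) (ℤP.neg-mono-≤ (eigenForm-nonpos d≤k d<y y<v R≥0))))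

    d≡k-at-v : ∀ {d} → 0 ℕ.< v → d ℕ.≤ k → (∀ x → + 0 ℤ.≤ R x (+ v) (+ d)) → d ≡ k
    d≡k-at-v {d} (s≤s _) d≤k R≥0 = ℕP.≤-antisym d≤k (ℕP.m∸n≡0⇒m≤n
      (ℕP.m*n≡0⇒m≡0 (k ℕ.∸ d) (2 ℕ.* v)
        (bounded-below-linear⇒0 r₀ _ (λ x → subst (+ 0 ℤ.≤_) (Rx≡ x) (R≥0 x)))))
      where
      r₀ = R (+ 0) (+ v) (+ d)
      linear : ∀ r₀ x a b → r₀ + x * ((x + + 1) * + 0 - + 2 * (a * b)) ≡ r₀ - x * (b * (+ 2 * a))
      linear = solve-∀
      Rx≡ : ∀ x → R x (+ v) (+ d) ≡ r₀ - x * + ((k ℕ.∸ d) ℕ.* (2 ℕ.* v))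
      Rx≡ x = begin
        R x (+ v) (+ d)
          ≡⟨ R-expand (+ v) (+ k) L (+ m) x (+ v) (+ d) ⟩
        r₀ + x * ((x + + 1) * (+ v - + v) - + 2 * (+ v * (+ k - + d)))
          ≡⟨ cong₂ (λ a b → r₀ + x * ((x + + 1) * a - + 2 * (+ v * b)))
                   (ℤP.+-inverseʳ (+ v)) (pos-∸ d≤k) ⟩
        r₀ + x * ((x + + 1) * + 0 - + 2 * (+ v * + (k ℕ.∸ d)))
          ≡⟨ linear r₀ x (+ v) (+ (k ℕ.∸ d)) ⟩
        r₀ - x * (+ (k ℕ.∸ d) * (+ 2 * + v))
          ≡⟨ cong (λ t → r₀ - x * t) (trans (cong (+ (k ℕ.∸ d) *_) (sym (ℤP.pos-* 2 v)))
                                            (sym (ℤP.pos-* (k ℕ.∸ d) (2 ℕ.* v)))) ⟩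
        r₀ - x * + ((k ℕ.∸ d) ℕ.* (2 ℕ.* v)) ∎
        where open ≡-Reasoning

module HaemersBounds {v k l m} (ids : Counting.SRGIdentities v k l m) where

  open import Defs hiding (sym)
  open Surds
  open RestrictedEigenvalues
  open import Data.Nat as ℕ using (ℕ; suc; z≤n; s≤s)
  import Data.Nat.Properties as ℕP
  open import Data.Integer as ℤ using (ℤ; +_; _+_; _-_; _*_; -_; +≤+)
  import Data.Integer.Properties as ℤP
  open import Data.Integer.Tactic.RingSolver using (solve-∀)
  open import Data.Sum using (inj₁; inj₂)
  open import Data.Product using (_,_; proj₂)
  open import Relation.Binary.PropositionalEquality
  open SRGParams v k l m
  open Counting.SRGIdentities ids
  open BetweenEigenvalues ids

  γ : ℕ
  γ = k ℕ.+ suc n₁ ℕ.+ m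

  +k≡ : + k ≡ + l + + suc n₁
  +k≡ = trans (cong +_ k≡l+1+n₁) (ℤP.pos-+ l (suc n₁))

  +γ≡ : + γ ≡ + k + + suc n₁ + + m
  +γ≡ = trans (ℤP.pos-+ (k ℕ.+ suc n₁) m) (cong (_+ + m) (ℤP.pos-+ k (suc n₁)))

  2k-L≡γ : + (2 ℕ.* k) + - L ≡ + γ
  2k-L≡γ = begin
    + (2 ℕ.* k) + - L                            ≡⟨ cong (_+ - L) (ℤP.pos-* 2 k) ⟩
    + 2 * + k + - L                              ≡⟨ cong (λ t → + 2 * t + - L) +k≡ ⟩
    + 2 * (+ l + + suc n₁) + - (+ l - + m)       ≡⟨ regroup (+ l) (+ suc n₁) (+ m) ⟩
    (+ l + + suc n₁) + + suc n₁ + + m            ≡⟨ cong (λ t → t + + suc n₁ + + m) (sym +k≡) ⟩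
    + k + + suc n₁ + + m                         ≡⟨ sym +γ≡ ⟩
    + γ                                          ∎
    where
    open ≡-Reasoning
    regroup : ∀ a b c → + 2 * (a + b) + - (a - c) ≡ a + b + b + c
    regroup = solve-∀

  haemGeDen≡ : haemGeDen ≡ (+ γ , + 1)
  haemGeDen≡ = cong (_, + 1) 2k-L≡γ

  haemLeDen≡ : haemLeDen ≡ (+ γ , - + 1)
  haemLeDen≡ = cong (_, - + 1) 2k-L≡γ

  0≤Δ : + 0 ℤ.≤ Δ
  0≤Δ = ℤP.+-mono-≤ (≡pos⇒0≤ (sq≡ L)) (0≤* {+ 4} (+≤+ z≤n) (0≤m-n m≤k))

  Δ≤γ² : Δ ℤ.≤ + γ * + γ
  Δ≤γ² = ℤP.0≤i-j⇒j≤i (subst (+ 0 ℤ.≤_) (sym γ²-Δ≡) (0≤* {+ 4} (+≤+ z≤n) 0≤rest))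
    where
    rest = + k * (+ n₁ + + m) + + m
    0≤rest : + 0 ℤ.≤ rest
    0≤rest = ≡pos⇒0≤ (sym (trans (ℤP.pos-+ (k ℕ.* (n₁ ℕ.+ m)) m)
                                 (cong (_+ + m) (ℤP.pos-* k (n₁ ℕ.+ m)))))
    identity : ∀ a b c → (a + (+ 1 + b) + (+ 1 + b) + c) * (a + (+ 1 + b) + (+ 1 + b) + c)
                         - ((a - c) * (a - c) + + 4 * (a + (+ 1 + b) - c))
                       ≡ + 4 * ((a + (+ 1 + b)) * (b + c) + c)
    identity = solve-∀
    γ²-Δ≡ : + γ * + γ - Δ ≡ + 4 * rest
    γ²-Δ≡ = begin
      + γ * + γ - Δ
        ≡⟨ cong (λ t → t * t - Δ) +γ≡ ⟩
      (+ k + + suc n₁ + + m) * (+ k + + suc n₁ + + m) - (L * L + + 4 * (+ k - + m))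
        ≡⟨ cong (λ t → (t + + suc n₁ + + m) * (t + + suc n₁ + + m) - (L * L + + 4 * (t - + m))) +k≡ ⟩
      _ ≡⟨ identity (+ l) (+ n₁) (+ m) ⟩
      + 4 * ((+ l + + suc n₁) * (+ n₁ + + m) + + m)
        ≡⟨ cong (λ t → + 4 * (t * (+ n₁ + + m) + + m)) (sym +k≡) ⟩
      + 4 * rest ∎
      where open ≡-Reasoning

  haemGe-gap : ∀ d y → sAdd (haemGeNum d) (sNeg (sMul Δ (ofℤ (+ y)) haemGeDen)) ≡ (gap d y , + v - + y)
  haemGe-gap d y = trans (cong₂ F (ℤP.pos-* 2 d) (ℤP.pos-* 2 k))
    (cong₂ _,_ (gap-identity (+ v) (+ y) (+ d) (+ k) L)
               (width-identity (+ v) (+ y)))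
    where
    F : ℤ → ℤ → Surd
    F a b = sAdd (sMul Δ (ofℤ (+ v)) (sAdd (ofℤ a) (sNeg twoσ)))
                 (sNeg (sMul Δ (ofℤ (+ y)) (sAdd (ofℤ b) (sNeg twoσ))))
    gap-identity : ∀ V Y D K L →
      V * (+ 2 * D + - L) + + 0 + - (Y * (+ 2 * K + - L) + + 0)
      ≡ + 2 * (V * D - Y * K) - L * (V - Y)
    gap-identity = solve-∀
    width-identity : ∀ V Y → V * + 1 + + 0 + - (Y * + 1 + + 0) ≡ V - Y
    width-identity = solve-∀

  haemLe-gap : ∀ d y → sAdd (sMul Δ (ofℤ (+ y)) haemLeDen) (sNeg (haemLeNum d)) ≡ (- gap d y , + v - + y)
  haemLe-gap d y = trans (cong₂ F (ℤP.pos-* 2 d) (ℤP.pos-* 2 k))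
    (cong₂ _,_ (gap-identity (+ v) (+ y) (+ d) (+ k) L) (width-identity (+ v) (+ y)))
    where
    F : ℤ → ℤ → Surd
    F a b = sAdd (sMul Δ (ofℤ (+ y)) (sAdd (ofℤ b) (sNeg twoρ)))
                 (sNeg (sMul Δ (ofℤ (+ v)) (sAdd (ofℤ a) (sNeg twoρ))))
    gap-identity : ∀ V Y D K L →
      Y * (+ 2 * K + - L) + + 0 + - (V * (+ 2 * D + - L) + + 0)
      ≡ - (+ 2 * (V * D - Y * K) - L * (V - Y))
    gap-identity = solve-∀
    width-identity : ∀ V Y → Y * - + 1 + + 0 + - (V * - + 1 + + 0) ≡ V - Y
    width-identity = solve-∀

  v-above-haemLe : ∀ {d} → d ℕ.≤ k → haemLeNum d ≤[ Δ ] sMul Δ (ofℤ (+ v)) haemLeDen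
  v-above-haemLe {d} d≤k = subst (NonNeg Δ) (sym (haemLe-gap d v)) (inj₁ (0≤-gap , 0≤m-n {v} ℕP.≤-refl))
    where
    identity : ∀ a b c L → - (+ 2 * (a * b - a * c) - L * (a - a)) ≡ + 2 * a * (c - b)
    identity = solve-∀
    0≤-gap : + 0 ℤ.≤ - gap d v
    0≤-gap = subst (+ 0 ℤ.≤_) (sym (identity (+ v) (+ d) (+ k) L))
               (0≤* {+ 2 * + v} (≡pos⇒0≤ (sym (ℤP.pos-* 2 v))) (0≤m-n d≤k))

  0-below-haemGe : ∀ d → sMul Δ (ofℤ (+ 0)) haemGeDen ≤[ Δ ] haemGeNum d
  0-below-haemGe d = subst (NonNeg Δ) (sym (trans (haemGe-gap d 0) (cong (_, + v + + 0) gap≡)))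
                       (nonNeg-+ {a = - L * + v} 0≤Δ (2 ℕ.* (v ℕ.* d)) 0
                         (nonNeg-of-sq≤ (+≤+ z≤n) L²v²≤v²Δ))
    where
    identity : ∀ V L c → V * V * (L * L + + 4 * c) - - L * V * (- L * V) ≡ V * V * (+ 4 * c)
    identity = solve-∀
    L²v²≤v²Δ : - L * + v * (- L * + v) ℤ.≤ + v * + v * Δ
    L²v²≤v²Δ = ℤP.0≤i-j⇒j≤i (subst (+ 0 ℤ.≤_) (sym (identity (+ v) L (+ k - + m)))
                 (0≤* {+ v * + v} (≡pos⇒0≤ (sym (ℤP.pos-* v v))) (0≤* {+ 4} (+≤+ z≤n) (0≤m-n m≤k))))
    regroup : ∀ V D K L → + 2 * (V * D - + 0 * K) - L * (V - + 0) ≡ - L * V + + 2 * (V * D)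
    regroup = solve-∀
    gap≡ : gap d 0 ≡ - L * + v + + (2 ℕ.* (v ℕ.* d))
    gap≡ = trans (regroup (+ v) (+ d) (+ k) L)
             (cong (λ t → - L * + v + t) (trans (cong (+ 2 *_) (sym (ℤP.pos-* v d))) (sym (ℤP.pos-* 2 (v ℕ.* d)))))

  inS⇒below-haemGe : ∀ {d y} → d ℕ.≤ k → InS d y → sMul Δ (ofℤ (+ y)) haemGeDen ≤[ Δ ] haemGeNum d
  inS⇒below-haemGe {d} {y} d≤k (d<y , y≤v , R≥0) with ℕP.m≤n⇒m<n∨m≡n y≤v
  ... | inj₁ y<v  = subst (NonNeg Δ) (sym (haemGe-gap d y))
                      (nonNeg-of-sq≤ (0≤m-n y≤v) (gap²≤ d≤k d<y y<v R≥0))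
  ... | inj₂ refl = subst (NonNeg Δ) (sym (trans (haemGe-gap d v) (cong₂ _,_ gap≡0 (ℤP.+-inverseʳ (+ v)))))
                      (inj₁ (ℤP.≤-refl , ℤP.≤-refl))
    where
    identity : ∀ a b L → + 2 * (a * b - a * b) - L * (a - a) ≡ + 0
    identity = solve-∀
    gap≡0 : gap d v ≡ + 0
    gap≡0 rewrite d≡k-at-v (ℕP.<-≤-trans (s≤s z≤n) d<y) d≤k R≥0 = identity (+ v) (+ k) L

  inS⇒above-haemLe : ∀ {d y} → d ℕ.≤ k → InS d y → haemLeNum d ≤[ Δ ] sMul Δ (ofℤ (+ y)) haemLeDen
  inS⇒above-haemLe {d} {y} d≤k (d<y , y≤v , R≥0) with ℕP.m≤n⇒m<n∨m≡n y≤v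
  ... | inj₁ y<v  = subst (NonNeg Δ) (sym (haemLe-gap d y)) (nonNeg-of-sq≤ (0≤m-n y≤v)
                      (subst (ℤ._≤ (+ v - + y) * (+ v - + y) * Δ) (sym (neg-sq (gap d y)))
                             (gap²≤ d≤k d<y y<v R≥0)))
    where
    neg-sq : ∀ a → - a * - a ≡ a * a
    neg-sq = solve-∀
  ... | inj₂ refl = v-above-haemLe d≤k

  below-haemGe⇒≤floor : ∀ d {y n} → sMul Δ (ofℤ (+ y)) haemGeDen ≤[ Δ ] haemGeNum d →
                        IsFloorHaemGe d n → + y ℤ.≤ n
  below-haemGe⇒≤floor d {y} below = floor-maximal {Δ} {haemGeNum d} {haemGeDen} (+ y) λ j j≤y →
    subst (λ den → sMul Δ (ofℤ j) den ≤[ Δ ] haemGeNum d) (sym haemGeDen≡)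
      (≤[]-downward {Δ} {γ} {haemGeNum d} 0≤Δ j≤y
        (subst (λ den → sMul Δ (ofℤ (+ y)) den ≤[ Δ ] haemGeNum d) haemGeDen≡ below))

  above-haemLe⇒ceil≤ : ∀ d {y n} → y ℕ.≤ v → haemLeNum d ≤[ Δ ] sMul Δ (ofℤ (+ y)) haemLeDen →
                       IsCeilHaemLe d n → n ℤ.≤ + y
  above-haemLe⇒ceil≤ d {y} y≤v above = ceil-minimal {Δ} {haemLeNum d} {haemLeDen} (+ y) λ j y≤j →
    subst (λ den → haemLeNum d ≤[ Δ ] sMul Δ (ofℤ j) den) (sym haemLeDen≡)
      (≤[]-upward {Δ} {γ} {haemLeNum d} 0≤Δ Δ≤γ² y≤j
        (subst (+ 0 ℤ.≤_) (sym (cong proj₂ (haemLe-gap d y))) (0≤m-n y≤v))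
        (subst (λ den → haemLeNum d ≤[ Δ ] sMul Δ (ofℤ (+ y)) den) haemLeDen≡ above))

open import Defs
open import Data.Nat using (ℕ; suc; _≤_)
open import Data.Nat.Properties using (n≤1+n; ≤-refl)
open import Data.Integer using (ℤ; +_; +≤+)
import Data.Integer as ℤ
open import Data.Integer.Properties using (≤-trans)
open import Data.Sum using (inj₁; inj₂)
open import Data.Product using (_×_; _,_)
open import Relation.Binary.PropositionalEquality using (refl)
open Counting using (srg-identities)

theorem5p5 : ∀ {v} (G : Graph v) (k l m : ℕ) → IsSRG G k l m →
    (d : ℕ) → d ≤ k →
    (∀ (r : ℕ) (n : ℤ) → SRGParams.IsRabGe v k l m d r →
        SRGParams.IsFloorHaemGe v k l m d n → (+ r) ℤ.≤ n)
    × (Connected G → ∀ (r : ℕ) (n : ℤ) → SRGParams.IsRabLe v k l m d r →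
        SRGParams.IsCeilHaemLe v k l m d n → n ℤ.≤ (+ r))
theorem5p5 {v} G k l m srg d d≤k = rabGe≤⌊haemGe⌋ , ⌈haemLe⌉≤rabLe
  where
  open SRGParams v k l m using (IsRabGe; IsRabLe; IsFloorHaemGe; IsCeilHaemLe)
  open HaemersBounds (srg-identities G srg)
  rabGe≤⌊haemGe⌋ : ∀ r n → IsRabGe d r → IsFloorHaemGe d n → + r ℤ.≤ n
  rabGe≤⌊haemGe⌋ r  n (inj₁ (r∈S , _))  = below-haemGe⇒≤floor d (inS⇒below-haemGe d≤k r∈S)
  rabGe≤⌊haemGe⌋ .0 n (inj₂ (_ , refl)) = below-haemGe⇒≤floor d (0-below-haemGe d)
  -- Connectedness only makes ρ the second largest eigenvalue; the bound does not need it.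
  ⌈haemLe⌉≤rabLe : Connected G → ∀ r n → IsRabLe d r → IsCeilHaemLe d n → n ℤ.≤ + r
  ⌈haemLe⌉≤rabLe _ r n (inj₁ (r∈S@(_ , r≤v , _) , _)) =
    above-haemLe⇒ceil≤ d r≤v (inS⇒above-haemLe d≤k r∈S)
  ⌈haemLe⌉≤rabLe _ .(suc v) n (inj₂ (_ , refl)) ceil =
    ≤-trans (above-haemLe⇒ceil≤ d ≤-refl (v-above-haemLe d≤k) ceil) (+≤+ (n≤1+n v))
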